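{- Let $G$ be a $k$-monotone bipartite $\epsilon$-expander with ordered bipartition $A=(v_1,\dots,v_n)$ and $B=(w_1,\dots,w_m)$. Let $G'$ be the graph with $V(G')=V(G)$ and $E(G')=\{v_iw_j,\ v_jw_i : v_iw_j\in E(G)\}$. Then $G'$ (with the same ordered bipartition) is a two-sided $2k$-monotone bipartite $\epsilon$-expander.
   Context: For $\epsilon\in(0,1]$, a bipartite graph $G$ with bipartition $A,B$ is a bipartite $\epsilon$-expander if $|A|=|B|$ and $|N(S)|\geq(1+\epsilon)|S|$ for every $S\subset A$ with $|S|\leq|A|/2$; it is a two-sided bipartite $\epsilon$-expander if in addition $|N(T)|\geq(1+\epsilon)|T|$ for every $T\subset B$ with $|T|\leq|B|/2$. Here $N(S)$ is the set of vertices adjacent to some vertex of $S$. For ordered colour classes $(v_1,\dots,v_n)$, $(w_1,\dots,w_m)$, edges $v_iw_j$ and $v_kw_\ell$ cross if $i<k$ and $\ell<j$; a matching is monotone if no two of its edges cross; the graph is $d$-monotone if its edge set is the union of $d$ monotone matchings.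
   Formalization: The expansion parameter ε ranges over the rationals in (0,1]. -}

module Defs where

open import Data.Nat as ℕ using (ℕ; _*_)
open import Data.Bool using (Bool; true; false; _∧_; _∨_)
open import Data.Fin using (Fin; zero; suc)
import Data.Fin as Fin
open import Data.Fin.Subset using (Subset; _∈_; ∣_∣)
open import Data.Vec using (tabulate; lookup)
open import Data.Integer using (+_)
open import Data.Rational as ℚ using (ℚ; 1ℚ)
open import Data.Product using (Σ; _×_; ∃)
open import Relation.Binary.PropositionalEquality using (_≡_)
open import Relation.Nullary using (¬_)
open import Function.Bundles using (_⇔_)

-- A bipartite graph with ordered colour classes A = (v_0,…,v_{n-1}) and
-- B = (w_0,…,w_{m-1}); G i j ≡ true  iff  v_i w_j is an edge.
BGraph : ℕ → ℕ → Set
BGraph n m = Fin n → Fin m → Bool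

anyFin : ∀ {n} → (Fin n → Bool) → Bool
anyFin {ℕ.zero} f = false
anyFin {ℕ.suc n} f = f zero ∨ anyFin (λ i → f (suc i))

NA : ∀ {n m} → BGraph n m → Subset n → Subset m
NA G S = tabulate (λ j → anyFin (λ i → lookup S i ∧ G i j))

NB : ∀ {n m} → BGraph n m → Subset m → Subset n
NB G T = tabulate (λ i → anyFin (λ j → lookup T j ∧ G i j))

ℕ→ℚ : ℕ → ℚ
ℕ→ℚ k = (+ k) ℚ./ 1

-- bipartite ε-expander (|A| = |B| is built in: both classes have n vertices)
-- |N(S)| ≥ (1+ε)|S| for all S ⊆ A with |S| ≤ |A|/2  (i.e. 2|S| ≤ n)
IsExpander : ∀ {n} → ℚ → BGraph n n → Set
IsExpander {n} ε G =
  ∀ (S : Subset n) → 2 * ∣ S ∣ ℕ.≤ n →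
    (1ℚ ℚ.+ ε) ℚ.* ℕ→ℚ ∣ S ∣ ℚ.≤ ℕ→ℚ ∣ NA G S ∣

IsTwoSidedExpander : ∀ {n} → ℚ → BGraph n n → Set
IsTwoSidedExpander {n} ε G =
  IsExpander ε G ×
  (∀ (T : Subset n) → 2 * ∣ T ∣ ℕ.≤ n →
    (1ℚ ℚ.+ ε) ℚ.* ℕ→ℚ ∣ T ∣ ℚ.≤ ℕ→ℚ ∣ NB G T ∣)

IsMatching : ∀ {n m} → BGraph n m → Set
IsMatching M =
  (∀ i j j' → M i j ≡ true → M i j' ≡ true → j ≡ j') ×
  (∀ i i' j → M i j ≡ true → M i' j ≡ true → i ≡ i')

IsMonotoneMatching : ∀ {n m} → BGraph n m → Set
IsMonotoneMatching M =
  IsMatching M ×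
  (∀ i j k l → M i j ≡ true → M k l ≡ true → ¬ (i Fin.< k × l Fin.< j))

IsMonotone : ∀ {n m} → ℕ → BGraph n m → Set
IsMonotone {n} {m} d G =
  Σ (Fin d → BGraph n m) λ M →
    (∀ c → IsMonotoneMatching (M c)) ×
    (∀ i j → (G i j ≡ true) ⇔ ∃ (λ c → M c i j ≡ true))

symmetrize : ∀ {n} → BGraph n n → BGraph n n
symmetrize G i j = G i j ∨ G j i

-- Adding edges only enlarges neighbourhoods.  G' = G ∪ Gᵀ contains G, so it
-- expands from A; the B-side neighbourhoods of G' are the A-side neighbourhoods
-- of G'ᵀ = Gᵀ ∪ G, which also contains G, so it expands from B as well.  The
-- transpose of a monotone matching is a monotone matching, so the k matchings
-- of G together with their k transposes cover G'.
module Submission where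

open import Defs
open import Data.Nat using (ℕ; _*_; _+_)
open import Data.Rational using (ℚ; 0ℚ; 1ℚ; _<_; _≤_)
open import Data.Product using (_×_; ∃; _,_)
open import Data.Bool using (Bool; true; false; _∧_; _∨_)
open import Data.Fin using (Fin; zero; suc; splitAt; _↑ˡ_; _↑ʳ_)
open import Data.Fin.Properties using (splitAt-↑ˡ; splitAt-↑ʳ)
open import Data.Fin.Subset using (Subset; _⊆_)
open import Data.Fin.Subset.Properties using (p⊆q⇒∣p∣≤∣q∣)
import Data.Integer as ℤ
import Data.Integer.Properties as ℤ
import Data.Nat as ℕ
import Data.Nat.Coprimality as Coprime
open import Data.Nat.Properties using (+-identityʳ)
import Data.Rational as ℚ
import Data.Rational.Properties as ℚ
open import Data.Sum using (_⊎_; inj₁; inj₂; [_,_]′)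
open import Data.Vec using (tabulate; lookup)
open import Data.Vec.Properties using (lookup∘tabulate; []=⇒lookup; lookup⇒[]=)
open import Function using (_∘_)
open import Function.Bundles using (mk⇔; Equivalence)
open import Relation.Binary.PropositionalEquality
  using (_≡_; refl; sym; cong; subst; trans; module ≡-Reasoning)

private
  variable
    n m d e : ℕ

∨-introˡ : ∀ a {b} → a ≡ true → a ∨ b ≡ true
∨-introˡ true _ = refl

∨-introʳ : ∀ a {b} → b ≡ true → a ∨ b ≡ true
∨-introʳ true  _   = refl
∨-introʳ false b≡t = b≡t

∨-elim : ∀ a {b} → a ∨ b ≡ true → a ≡ true ⊎ b ≡ true
∨-elim true  _   = inj₁ refl
∨-elim false b≡t = inj₂ b≡t

∧-monoʳ : ∀ a {b c} → (b ≡ true → c ≡ true) → a ∧ b ≡ true → a ∧ c ≡ true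
∧-monoʳ true b⇒c = b⇒c

anyFin-mono : {f g : Fin n → Bool} → (∀ i → f i ≡ true → g i ≡ true) →
              anyFin f ≡ true → anyFin g ≡ true
anyFin-mono {ℕ.suc n} {f} {g} f⇒g any-f with ∨-elim (f zero) any-f
... | inj₁ f₀ = ∨-introˡ (g zero) (f⇒g zero f₀)
... | inj₂ f₊ = ∨-introʳ (g zero) (anyFin-mono (f⇒g ∘ suc) f₊)

tabulate-⊆ : {f g : Fin n → Bool} → (∀ i → f i ≡ true → g i ≡ true) →
             tabulate f ⊆ tabulate g
tabulate-⊆ {f = f} {g} f⇒g {i} i∈f = lookup⇒[]= i (tabulate g) (begin
  lookup (tabulate g) i ≡⟨ lookup∘tabulate g i ⟩
  g i                   ≡⟨ f⇒g i (trans (sym (lookup∘tabulate f i)) ([]=⇒lookup i∈f)) ⟩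
  true                  ∎)
  where open ≡-Reasoning

ℕ→ℚ-mono : ∀ {a b} → a ℕ.≤ b → ℕ→ℚ a ≤ ℕ→ℚ b
ℕ→ℚ-mono {a} {b} a≤b
  rewrite ℚ.normalize-coprime (Coprime.sym (Coprime.1-coprimeTo a))
        | ℚ.normalize-coprime (Coprime.sym (Coprime.1-coprimeTo b))
  = ℚ.*≤* (ℤ.*-monoʳ-≤-nonNeg (ℤ.+ 1) (ℤ.+≤+ a≤b))

_⊆ᴱ_ : BGraph n m → BGraph n m → Set
G ⊆ᴱ H = ∀ i j → G i j ≡ true → H i j ≡ true

_∪ᴱ_ : BGraph n m → BGraph n m → BGraph n m
(G ∪ᴱ H) i j = G i j ∨ H i j

transpose : BGraph n m → BGraph m n
transpose G j i = G i j

⊆ᴱ-∪ˡ : (G H : BGraph n m) → G ⊆ᴱ (G ∪ᴱ H)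
⊆ᴱ-∪ˡ G H i j = ∨-introˡ (G i j)

⊆ᴱ-∪ʳ : (G H : BGraph n m) → H ⊆ᴱ (G ∪ᴱ H)
⊆ᴱ-∪ʳ G H i j = ∨-introʳ (G i j)

NA-mono : {G H : BGraph n m} → G ⊆ᴱ H → (S : Subset n) → NA G S ⊆ NA H S
NA-mono G⊆H S = tabulate-⊆ λ j → anyFin-mono λ i → ∧-monoʳ (lookup S i) (G⊆H i j)

IsExpander-mono : ∀ ε {G H : BGraph n n} → G ⊆ᴱ H → IsExpander ε G → IsExpander ε H
IsExpander-mono _ G⊆H expand S small =
  ℚ.≤-trans (expand S small) (ℕ→ℚ-mono (p⊆q⇒∣p∣≤∣q∣ (NA-mono G⊆H S)))

transpose-IsMonotoneMatching : {M : BGraph n m} →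
  IsMonotoneMatching M → IsMonotoneMatching (transpose M)
transpose-IsMonotoneMatching ((unique-right , unique-left) , no-crossing) =
  ((λ j i i′ → unique-left i i′ j) , (λ j j′ i → unique-right i j j′)) ,
  λ j i l k Mij Mkl (j<l , k<i) → no-crossing k l i j Mkl Mij (k<i , j<l)

IsMonotone-transpose : {G : BGraph n m} → IsMonotone d G → IsMonotone d (transpose G)
IsMonotone-transpose (M , M-monotone , M-covers) =
  (λ c → transpose (M c)) ,
  (λ c → transpose-IsMonotoneMatching (M-monotone c)) ,
  (λ j i → M-covers i j)

IsMonotone-∪ : {G H : BGraph n m} →
  IsMonotone d G → IsMonotone e H → IsMonotone (d + e) (G ∪ᴱ H)
IsMonotone-∪ {n} {m} {d} {e} {G} {H} (M , M-monotone , M-covers) (N , N-monotone , N-covers) =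
  L , L-monotone , λ i j → mk⇔ (covered i j) (in-union i j)
  where
  open Equivalence

  L : Fin (d + e) → BGraph n m
  L c = [ M , N ]′ (splitAt d c)

  L-monotone : ∀ c → IsMonotoneMatching (L c)
  L-monotone c with splitAt d c
  ... | inj₁ a = M-monotone a
  ... | inj₂ b = N-monotone b

  L-↑ˡ : ∀ a i j → L (a ↑ˡ e) i j ≡ M a i j
  L-↑ˡ a i j = cong (λ s → [ M , N ]′ s i j) (splitAt-↑ˡ d a e)

  L-↑ʳ : ∀ b i j → L (d ↑ʳ b) i j ≡ N b i j
  L-↑ʳ b i j = cong (λ s → [ M , N ]′ s i j) (splitAt-↑ʳ d e b)

  covered : ∀ i j → (G ∪ᴱ H) i j ≡ true → ∃ λ c → L c i j ≡ true
  covered i j Gij∨Hij with ∨-elim (G i j) Gij∨Hij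
  ... | inj₁ Gij with a , Mij ← to (M-covers i j) Gij = a ↑ˡ e , trans (L-↑ˡ a i j) Mij
  ... | inj₂ Hij with b , Nij ← to (N-covers i j) Hij = d ↑ʳ b , trans (L-↑ʳ b i j) Nij

  in-union : ∀ i j → (∃ λ c → L c i j ≡ true) → (G ∪ᴱ H) i j ≡ true
  in-union i j (c , Lij) with splitAt d c
  ... | inj₁ a = ∨-introˡ (G i j) (from (M-covers i j) (a , Lij))
  ... | inj₂ b = ∨-introʳ (G i j) (from (N-covers i j) (b , Lij))

lemma6 : (n k : ℕ) (ε : ℚ) (G : BGraph n n) →
    0ℚ < ε → ε ≤ 1ℚ →
    IsMonotone k G → IsExpander ε G →
    IsTwoSidedExpander ε (symmetrize G) × IsMonotone (2 * k) (symmetrize G)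
lemma6 n k ε G _ _ monotone expander =
  (IsExpander-mono ε (⊆ᴱ-∪ˡ G (transpose G)) expander ,
   IsExpander-mono ε (⊆ᴱ-∪ʳ (transpose G) G) expander) ,
  IsMonotone-∪ monotone
    (subst (λ d → IsMonotone d (transpose G)) (sym (+-identityʳ k))
      (IsMonotone-transpose monotone))
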